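{- Let $q$ be a prime power with $q\equiv 1\pmod 3$, and let $C_A(q)$ be the contraction graph of $AGL(1,q)$ with respect to a distinguished element $F\in GF(q)$. Let $\pi$ be a non-isolated vertex of $C_A(q)$, say $\pi(x)=ax+r$, and let $t_1\in GF(q)$ be a root of $t^2+t+1=0$. Then the neighbors of $\pi$ in $C_A(q)$ are exactly $\sigma_1$ and $\sigma_2$, where $\sigma_1(x)=at_1x+(a-t_1)F+r(1+t_1)$ and $\sigma_2(x)=a\frac{1}{t_1}x+(a-\frac{1}{t_1})F+r(1+\frac{1}{t_1})$. In particular every non-isolated vertex of $C_A(q)$ has degree $2$.
   Context: $AGL(1,q)$ is the group of maps $x\mapsto ax+b$ on $GF(q)$ with $a\neq 0$. For permutations $\pi,\sigma$, $hd(\pi,\sigma)=|\{x:\pi(x)\neq\sigma(x)\}|$. Fix $F\in GF(q)$. For a permutation $\pi$ of $GF(q)$, $\pi^{\triangle}$ is the permutation with $\pi^{\triangle}(\pi^{ -1}(F))=\pi(F)$, $\pi^{\triangle}(F)=F$, and $\pi^{\triangle}(x)=\pi(x)$ otherwise. The contraction graph $C_A(q)$ has vertex set $AGL(1,q)$, and distinct $\pi,\sigma$ are adjacent iff $hd(\pi^{\triangle},\sigma^{\triangle})=q-4$. -}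

module Defs where

open import Level using (0ℓ)
open import Data.Nat using (ℕ; _∸_)
open import Data.Fin using (Fin)
open import Data.List using (List; length; filter)
open import Data.List.Base using (allFin)
open import Data.Product using (_×_; _,_; Σ; ∃)
open import Relation.Nullary using (¬_; Dec; yes; no; ¬?)
open import Relation.Binary.PropositionalEquality using (_≡_; _≢_)
open import Relation.Binary.Definitions using (DecidableEquality)
open import Algebra.Structures using (IsCommutativeRing)
open import Function.Bundles using (_⤖_; Bijection)

-- A finite field with exactly q elements (GF(q)); equality is propositional.
-- The inverse is total; only its values on non-zero elements are constrained.
record FiniteField (q : ℕ) : Set₁ where
  infixl 7 _*_
  infixl 6 _+_ _-_
  infix 8 _⁻¹
  field
    Carrier : Set
    _+_ _*_ : Carrier → Carrier → Carrier
    -_ : Carrier → Carrier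
    0# 1# : Carrier
    isCommutativeRing : IsCommutativeRing _≡_ _+_ _*_ -_ 0# 1#
    _⁻¹ : Carrier → Carrier
    ⁻¹-inverse : ∀ x → x ≢ 0# → x * (x ⁻¹) ≡ 1#
    0≢1 : 0# ≢ 1#
    _≟_ : DecidableEquality Carrier
    enum : Fin q ⤖ Carrier

  _-_ : Carrier → Carrier → Carrier
  x - y = x + (- y)

  open Bijection enum public using () renaming (to to elt)

module AGL {q : ℕ} (K : FiniteField q) (F : FiniteField.Carrier K) where
  open FiniteField K

  -- An element (a , b) of AGL(1,q) (with a ≢ 0#) represents x ↦ a x + b.
  Aff : Set
  Aff = Carrier × Carrier

  apply : Aff → Carrier → Carrier
  apply (a , b) x = a * x + b

  -- π^△ : π^△(F) = F, π^△(π⁻¹(F)) = π(F), π^△(x) = π(x) otherwise.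
  -- (x ≡ π⁻¹(F) is tested as π(x) ≡ F.)
  tri : Aff → Carrier → Carrier
  tri π x with x ≟ F
  ... | yes _ = F
  ... | no _ with apply π x ≟ F
  ...   | yes _ = apply π F
  ...   | no _ = apply π x

  hd : (Carrier → Carrier) → (Carrier → Carrier) → ℕ
  hd f g = length (filter (λ i → ¬? (f (elt i) ≟ g (elt i))) (allFin q))

  Adj : Aff → Aff → Set
  Adj π σ = π ≢ σ × hd (tri π) (tri σ) ≡ q ∸ 4

  IsVertex : Aff → Set
  IsVertex (a , b) = a ≢ 0#

  NonIsolated : Aff → Set
  NonIsolated π = Σ Aff (λ σ → IsVertex σ × Adj π σ)

module Submission where

-- π^△ and σ^△ both fix F, and elsewhere they can only agree at π⁻¹(F), at σ⁻¹(F) and at the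
-- (at most one) point where the affine maps π and σ themselves coincide; so they agree in at most
-- four points, and adjacency means they agree in exactly four. Then all four points are distinct
-- and the agreements at π⁻¹(F) and σ⁻¹(F) read π(F) = σ(π⁻¹F) and σ(F) = π(σ⁻¹F). For
-- π = ax + r and σ = bx + s these give a² + ab + b² = 0, i.e. b = a t₁ or b = a t₁⁻¹, and then
-- determine s. Conversely, for σ₁ and σ₂ the points F, π⁻¹F, σ⁻¹F and the coincidence point are
-- four distinct agreement points; their distinctness needs 3 ≠ 0, which the existence of one
-- neighbour of π guarantees: (a - b)² = (a² + ab + b²) - 3ab, so 3 = 0 would force a = b.

open import Level using (0ℓ)
open import Data.Nat as ℕ using (ℕ; zero; suc; _≤_; _∸_; _%_; z≤n; s≤s)
import Data.Nat.Properties as ℕ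
open import Data.Integer as ℤ using (ℤ; +_; -[1+_]; _⊖_; _◃_)
import Data.Integer.Properties as ℤ
open import Data.Sign as Sign using (Sign)
open import Data.Fin as Fin using (Fin)
open import Data.Maybe using (just; nothing)
open import Data.Product using (_×_; _,_; proj₁; proj₂)
open import Data.Sum as Sum using (_⊎_; inj₁; inj₂; [_,_])
open import Data.List as List using (List; []; _∷_; _++_; length; filter; map; allFin)
import Data.List.Properties as List
open import Data.List.Membership.Propositional using (_∈_)
open import Data.List.Membership.Propositional.Properties
  using (∈-∃++; ∈-++⁻; ∈-++⁺ˡ; ∈-++⁺ʳ; ∈-map⁺; ∈-map⁻; ∈-filter⁺; ∈-filter⁻; ∈-allFin)
open import Data.List.Relation.Binary.Subset.Propositional using (_⊆_)
open import Data.List.Relation.Unary.Any using (here; there)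
open import Data.List.Relation.Unary.All as All using (All; []; _∷_)
open import Data.List.Relation.Unary.AllPairs using ([]; _∷_)
open import Data.List.Relation.Unary.Unique.Propositional using (Unique)
import Data.List.Relation.Unary.Unique.Propositional.Properties as Unique
open import Function using (_∘_)
open import Function.Bundles using (Bijection; _⇔_; mk⇔)
open import Relation.Binary.Definitions using (WeaklyDecidable)
open import Relation.Binary.PropositionalEquality as ≡ using (_≡_; _≢_; ≢-sym)
open import Relation.Nullary using (¬_; Dec; yes; no; contradiction)
open import Relation.Nullary.Decidable using (decidable-stable)
open import Relation.Unary using (Pred; Decidable)
open import Relation.Unary.Properties using (∁?)
open import Algebra.Bundles using (CommutativeRing)
open import Defs

-- The ring solvers need coefficients whose equality decides by computation, which an abstract
-- field does not provide; we use ℤ, mapped into any commutative ring by n ↦ n · 1#.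
module IntegerCoefficients {c ℓ} (R : CommutativeRing c ℓ) where
  open CommutativeRing R
  open import Algebra.Properties.Ring ring using (-‿involutive; -0#≈0#; -‿distribˡ-*; -‿distribʳ-*)
  open import Algebra.Properties.AbelianGroup +-abelianGroup using (⁻¹-∙-comm; xyx⁻¹≈y)
  open import Algebra.Properties.Semiring.Mult.TCOptimised semiring using (×-homo-+; ×1-homo-*)
    renaming (_×_ to _·_)
  open import Algebra.Solver.Ring.AlmostCommutativeRing
  open import Relation.Binary.Reasoning.Setoid setoid

  ⟦_⟧ : ℤ → Carrier
  ⟦ + n ⟧ = n · 1#
  ⟦ -[1+ n ] ⟧ = - (suc n · 1#)

  ⊖-homo : ∀ m n → ⟦ m ⊖ n ⟧ ≈ m · 1# - n · 1#
  ⊖-homo m zero = begin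
    m · 1#          ≈⟨ +-identityʳ _ ⟨
    m · 1# + 0#     ≈⟨ +-congˡ -0#≈0# ⟨
    m · 1# - 0#     ∎
  ⊖-homo zero (suc n) = sym (+-identityˡ _)
  ⊖-homo (suc m) (suc n) = begin
    ⟦ suc m ⊖ suc n ⟧                          ≡⟨ ≡.cong ⟦_⟧ (ℤ.[1+m]⊖[1+n]≡m⊖n m n) ⟩
    ⟦ m ⊖ n ⟧                                  ≈⟨ ⊖-homo m n ⟩
    M - N                                      ≈⟨ xyx⁻¹≈y 1# (M - N) ⟨
    1# + (M - N) - 1#                          ≈⟨ +-congʳ (+-assoc 1# M (- N)) ⟨
    1# + M - N - 1#                            ≈⟨ +-assoc (1# + M) (- N) (- 1#) ⟩
    (1# + M) + (- N - 1#)                      ≈⟨ +-cong (×-homo-+ 1# 1 m) (sym (⁻¹-∙-comm N 1#)) ⟨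
    suc m · 1# - (N + 1#)                      ≈⟨ +-congˡ (-‿cong (trans (+-comm N 1#) (sym (×-homo-+ 1# 1 n)))) ⟩
    suc m · 1# - suc n · 1#                    ∎
    where M N : Carrier
          M = m · 1#
          N = n · 1#

  +-homo : ∀ i j → ⟦ i ℤ.+ j ⟧ ≈ ⟦ i ⟧ + ⟦ j ⟧
  +-homo (+ m) (+ n) = ×-homo-+ 1# m n
  +-homo (+ m) -[1+ n ] = ⊖-homo m (suc n)
  +-homo -[1+ m ] (+ n) = trans (⊖-homo n (suc m)) (+-comm _ _)
  +-homo -[1+ m ] -[1+ n ] = begin
    - (suc (suc (m ℕ.+ n)) · 1#)      ≡⟨ ≡.cong (λ k → - (suc k · 1#)) (ℕ.+-suc m n) ⟨
    - ((suc m ℕ.+ suc n) · 1#)        ≈⟨ -‿cong (×-homo-+ 1# (suc m) (suc n)) ⟩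
    - (suc m · 1# + suc n · 1#)       ≈⟨ ⁻¹-∙-comm _ _ ⟨
    ⟦ -[1+ m ] ⟧ + ⟦ -[1+ n ] ⟧       ∎

  -‿homo : ∀ i → ⟦ ℤ.- i ⟧ ≈ - ⟦ i ⟧
  -‿homo (+ zero) = sym -0#≈0#
  -‿homo (+ suc n) = refl
  -‿homo -[1+ n ] = sym (-‿involutive _)

  +◃-homo : ∀ n → ⟦ Sign.+ ◃ n ⟧ ≈ n · 1#
  +◃-homo zero = refl
  +◃-homo (suc n) = refl

  -◃-homo : ∀ n → ⟦ Sign.- ◃ n ⟧ ≈ - (n · 1#)
  -◃-homo zero = sym -0#≈0#
  -◃-homo (suc n) = refl

  *-homo : ∀ i j → ⟦ i ℤ.* j ⟧ ≈ ⟦ i ⟧ * ⟦ j ⟧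
  *-homo (+ m) (+ n) = trans (+◃-homo (m ℕ.* n)) (×1-homo-* m n)
  *-homo (+ m) -[1+ n ] = begin
    ⟦ Sign.- ◃ m ℕ.* suc n ⟧          ≈⟨ -◃-homo (m ℕ.* suc n) ⟩
    - ((m ℕ.* suc n) · 1#)            ≈⟨ -‿cong (×1-homo-* m (suc n)) ⟩
    - (m · 1# * suc n · 1#)           ≈⟨ -‿distribʳ-* _ _ ⟩
    m · 1# * ⟦ -[1+ n ] ⟧             ∎
  *-homo -[1+ m ] (+ n) = begin
    ⟦ Sign.- ◃ suc m ℕ.* n ⟧          ≈⟨ -◃-homo (suc m ℕ.* n) ⟩
    - ((suc m ℕ.* n) · 1#)            ≈⟨ -‿cong (×1-homo-* (suc m) n) ⟩
    - (suc m · 1# * n · 1#)           ≈⟨ -‿distribˡ-* _ _ ⟩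
    ⟦ -[1+ m ] ⟧ * n · 1#             ∎
  *-homo -[1+ m ] -[1+ n ] = begin
    ⟦ Sign.+ ◃ suc m ℕ.* suc n ⟧      ≈⟨ +◃-homo (suc m ℕ.* suc n) ⟩
    (suc m ℕ.* suc n) · 1#            ≈⟨ ×1-homo-* (suc m) (suc n) ⟩
    M * N                             ≈⟨ -‿involutive _ ⟨
    - - (M * N)                       ≈⟨ -‿cong (-‿distribˡ-* M N) ⟩
    - (- M * N)                       ≈⟨ -‿distribʳ-* (- M) N ⟩
    - M * - N                         ∎
    where M N : Carrier
          M = suc m · 1#
          N = suc n · 1#

  homomorphism : ℤ.+-*-rawRing -Raw-AlmostCommutative⟶ fromCommutativeRing R
  homomorphism = record
    { ⟦_⟧ = ⟦_⟧
    ; +-homo = +-homo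
    ; *-homo = *-homo
    ; -‿homo = -‿homo
    ; 0-homo = refl
    ; 1-homo = refl
    }

  coefficient≟ : WeaklyDecidable (Induced-equivalence homomorphism)
  coefficient≟ i j with i ℤ.≟ j
  ... | yes ≡.refl = just refl
  ... | no _ = nothing

  open import Algebra.Solver.Ring ℤ.+-*-rawRing (fromCommutativeRing R) homomorphism coefficient≟ public
    using (solve; _:+_; _:*_; :-_; _:-_; _:=_; con; Polynomial)

  0ᵖ 1ᵖ : ∀ {n} → Polynomial n
  0ᵖ = con (+ 0)
  1ᵖ = con (+ 1)

module _ {a} {A : Set a} where

  Unique-⊆⇒length≤ : ∀ {xs ys : List A} → Unique xs → xs ⊆ ys → length xs ≤ length ys
  Unique-⊆⇒length≤ {[]} _ _ = z≤n
  Unique-⊆⇒length≤ {x ∷ xs} (x∉xs ∷ unique) x∷xs⊆ys with ∈-∃++ (x∷xs⊆ys (here ≡.refl))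
  ... | ys₁ , ys₂ , ≡.refl = begin
    suc (length xs)              ≤⟨ s≤s (Unique-⊆⇒length≤ unique xs⊆ys₁++ys₂) ⟩
    suc (length (ys₁ ++ ys₂))    ≡⟨ ≡.cong suc (List.length-++ ys₁) ⟩
    suc (length ys₁ ℕ.+ length ys₂) ≡⟨ ℕ.+-suc (length ys₁) (length ys₂) ⟨
    length ys₁ ℕ.+ suc (length ys₂) ≡⟨ List.length-++ ys₁ ⟨
    length (ys₁ ++ x ∷ ys₂)      ∎
    where
    open ℕ.≤-Reasoning
    xs⊆ys₁++ys₂ : xs ⊆ ys₁ ++ ys₂
    xs⊆ys₁++ys₂ {y} y∈xs with ∈-++⁻ ys₁ (x∷xs⊆ys (there y∈xs))
    ... | inj₁ y∈ys₁ = ∈-++⁺ˡ y∈ys₁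
    ... | inj₂ (here y≡x) = contradiction (≡.sym y≡x) (All.lookup x∉xs y∈xs)
    ... | inj₂ (there y∈ys₂) = ∈-++⁺ʳ ys₁ y∈ys₂

  length-filter+length-filter-∁ : ∀ {p} {P : Pred A p} (P? : Decidable P) xs →
                                  length (filter P? xs) ℕ.+ length (filter (∁? P?) xs) ≡ length xs
  length-filter+length-filter-∁ P? [] = ≡.refl
  length-filter+length-filter-∁ P? (x ∷ xs) with P? x
  ... | yes _ = ≡.cong suc (length-filter+length-filter-∁ P? xs)
  ... | no _ = ≡.trans (ℕ.+-suc _ _) (≡.cong suc (length-filter+length-filter-∁ P? xs))

%3≡1⇒4≤ : ∀ {n} → n % 3 ≡ 1 → {i j : Fin n} → i ≢ j → 4 ≤ n
%3≡1⇒4≤ {1} _ {Fin.zero} {Fin.zero} i≢j = contradiction ≡.refl i≢j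
%3≡1⇒4≤ {suc (suc (suc (suc _)))} _ _ = s≤s (s≤s (s≤s (s≤s z≤n)))

module Field {q : ℕ} (K : FiniteField q) where
  open FiniteField K

  commutativeRing : CommutativeRing 0ℓ 0ℓ
  commutativeRing = record { isCommutativeRing = isCommutativeRing }

  open CommutativeRing commutativeRing public
    using (+-identityˡ; *-identityʳ; zeroˡ; zeroʳ; +-group)
  open IntegerCoefficients commutativeRing public
  open import Algebra.Properties.Group +-group public using (∙-cancelˡ)
  open import Algebra.Properties.Group +-group using (x∙y⁻¹≈ε⇒x≈y; x≈y⇒x∙y⁻¹≈ε)

  x-y≡0⇒x≡y : ∀ {x y} → x - y ≡ 0# → x ≡ y
  x-y≡0⇒x≡y = x∙y⁻¹≈ε⇒x≈y _ _

  x≡y⇒x-y≡0 : ∀ {x y} → x ≡ y → x - y ≡ 0#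
  x≡y⇒x-y≡0 = x≈y⇒x∙y⁻¹≈ε

  1≢0 : 1# ≢ 0#
  1≢0 1≡0 = 0≢1 (≡.sym 1≡0)

  -- Each algebraic lemma below writes its claim as a combination of hypotheses of the form
  -- lhs - rhs ≡ 0# (an ideal-membership certificate) and checks the certificate with solve.
  lincomb₁ : ∀ {x} c {y} → x ≡ c * y → y ≡ 0# → x ≡ 0#
  lincomb₁ c eq ≡.refl = ≡.trans eq (zeroʳ c)

  lincomb₂ : ∀ {x} c₁ {y₁} c₂ {y₂} → x ≡ c₁ * y₁ + c₂ * y₂ → y₁ ≡ 0# → y₂ ≡ 0# → x ≡ 0#
  lincomb₂ c₁ c₂ eq ≡.refl ≡.refl =
    ≡.trans eq (solve 2 (λ c₁ c₂ → c₁ :* 0ᵖ :+ c₂ :* 0ᵖ := 0ᵖ) ≡.refl c₁ c₂)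

  lincomb₃ : ∀ {x} c₁ {y₁} c₂ {y₂} c₃ {y₃} → x ≡ c₁ * y₁ + c₂ * y₂ + c₃ * y₃ →
             y₁ ≡ 0# → y₂ ≡ 0# → y₃ ≡ 0# → x ≡ 0#
  lincomb₃ c₁ c₂ c₃ eq ≡.refl ≡.refl ≡.refl =
    ≡.trans eq (solve 3 (λ c₁ c₂ c₃ → c₁ :* 0ᵖ :+ c₂ :* 0ᵖ :+ c₃ :* 0ᵖ := 0ᵖ) ≡.refl c₁ c₂ c₃)

  lincomb₄ : ∀ {x} c₁ {y₁} c₂ {y₂} c₃ {y₃} c₄ {y₄} → x ≡ c₁ * y₁ + c₂ * y₂ + c₃ * y₃ + c₄ * y₄ →
             y₁ ≡ 0# → y₂ ≡ 0# → y₃ ≡ 0# → y₄ ≡ 0# → x ≡ 0#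
  lincomb₄ c₁ c₂ c₃ c₄ eq ≡.refl ≡.refl ≡.refl ≡.refl =
    ≡.trans eq (solve 4 (λ c₁ c₂ c₃ c₄ → c₁ :* 0ᵖ :+ c₂ :* 0ᵖ :+ c₃ :* 0ᵖ :+ c₄ :* 0ᵖ := 0ᵖ) ≡.refl c₁ c₂ c₃ c₄)

  x*[y*x⁻¹]≡y : ∀ {x} y → x ≢ 0# → x * (y * x ⁻¹) ≡ y
  x*[y*x⁻¹]≡y {x} y x≢0 = begin
    x * (y * x ⁻¹)    ≡⟨ solve 3 (λ x y i → x :* (y :* i) := y :* (x :* i)) ≡.refl x y (x ⁻¹) ⟩
    y * (x * x ⁻¹)    ≡⟨ ≡.cong (y *_) (⁻¹-inverse x x≢0) ⟩
    y * 1#            ≡⟨ *-identityʳ y ⟩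
    y                 ∎
    where open ≡.≡-Reasoning

  *-cancelˡ : ∀ {x y z} → x ≢ 0# → x * y ≡ x * z → y ≡ z
  *-cancelˡ {x} {y} {z} x≢0 xy≡xz = begin
    y                 ≡⟨ x*[y*x⁻¹]≡y y x≢0 ⟨
    x * (y * x ⁻¹)    ≡⟨ solve 3 (λ x y i → x :* (y :* i) := x :* y :* i) ≡.refl x y (x ⁻¹) ⟩
    x * y * x ⁻¹      ≡⟨ ≡.cong (_* x ⁻¹) xy≡xz ⟩
    x * z * x ⁻¹      ≡⟨ solve 3 (λ x z i → x :* z :* i := x :* (z :* i)) ≡.refl x z (x ⁻¹) ⟩
    x * (z * x ⁻¹)    ≡⟨ x*[y*x⁻¹]≡y z x≢0 ⟩
    z                 ∎
    where open ≡.≡-Reasoning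

  x*y≡z⇒y≡z*x⁻¹ : ∀ {x y z} → x ≢ 0# → x * y ≡ z → y ≡ z * x ⁻¹
  x*y≡z⇒y≡z*x⁻¹ {z = z} x≢0 xy≡z = *-cancelˡ x≢0 (≡.trans xy≡z (≡.sym (x*[y*x⁻¹]≡y z x≢0)))

  x*y≡0⇒x≡0⊎y≡0 : ∀ {x y} → x * y ≡ 0# → x ≡ 0# ⊎ y ≡ 0#
  x*y≡0⇒x≡0⊎y≡0 {x} {y} xy≡0 with x ≟ 0#
  ... | yes x≡0 = inj₁ x≡0
  ... | no x≢0 = inj₂ (*-cancelˡ x≢0 (≡.trans xy≡0 (≡.sym (zeroʳ x))))

  x≢0∧y≢0⇒x*y≢0 : ∀ {x y} → x ≢ 0# → y ≢ 0# → x * y ≢ 0#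
  x≢0∧y≢0⇒x*y≢0 x≢0 y≢0 xy≡0 = [ x≢0 , y≢0 ] (x*y≡0⇒x≡0⊎y≡0 xy≡0)

  Φ₃ : Carrier → Carrier
  Φ₃ t = t * t + t + 1#

  3# : Carrier
  3# = 1# + 1# + 1#

  Φ₃-root⇒≢0 : ∀ {t} → Φ₃ t ≡ 0# → t ≢ 0#
  Φ₃-root⇒≢0 {t} root t≡0 = 1≢0 (lincomb₂ 1# (- (1# + t)) certificate root t≡0)
    where certificate : 1# ≡ 1# * Φ₃ t + (- (1# + t)) * t
          certificate = solve 1 (λ t → 1ᵖ := 1ᵖ :* (t :* t :+ t :+ 1ᵖ) :+ (:- (1ᵖ :+ t)) :* t) ≡.refl t

  Φ₃-root⇒1+t≢0 : ∀ {t} → Φ₃ t ≡ 0# → 1# + t ≢ 0#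
  Φ₃-root⇒1+t≢0 {t} root 1+t≡0 = 1≢0 (lincomb₂ 1# (- t) certificate root 1+t≡0)
    where certificate : 1# ≡ 1# * Φ₃ t + (- t) * (1# + t)
          certificate = solve 1 (λ t → 1ᵖ := 1ᵖ :* (t :* t :+ t :+ 1ᵖ) :+ (:- t) :* (1ᵖ :+ t)) ≡.refl t

  Φ₃-root⇒1-t≢0 : ∀ {t} → 3# ≢ 0# → Φ₃ t ≡ 0# → 1# - t ≢ 0#
  Φ₃-root⇒1-t≢0 {t} 3≢0 root 1-t≡0 = 3≢0 (lincomb₂ 1# (t + 1# + 1#) certificate root 1-t≡0)
    where certificate : 3# ≡ 1# * Φ₃ t + (t + 1# + 1#) * (1# - t)
          certificate = solve 1 (λ t → 1ᵖ :+ 1ᵖ :+ 1ᵖ := 1ᵖ :* (t :* t :+ t :+ 1ᵖ) :+ (t :+ 1ᵖ :+ 1ᵖ) :* (1ᵖ :- t)) ≡.refl t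

  Φ₃-root⇒⁻¹-root : ∀ {t} → Φ₃ t ≡ 0# → Φ₃ (t ⁻¹) ≡ 0#
  Φ₃-root⇒⁻¹-root {t} root =
    lincomb₂ (t ⁻¹ * t ⁻¹) (- (t ⁻¹ + 1# + 1# + (t * t ⁻¹ - 1#))) certificate root
      (x≡y⇒x-y≡0 (⁻¹-inverse t (Φ₃-root⇒≢0 root)))
    where certificate : Φ₃ (t ⁻¹) ≡ t ⁻¹ * t ⁻¹ * Φ₃ t + (- (t ⁻¹ + 1# + 1# + (t * t ⁻¹ - 1#))) * (t * t ⁻¹ - 1#)
          certificate = solve 2 (λ t t′ → t′ :* t′ :+ t′ :+ 1ᵖ :=
            t′ :* t′ :* (t :* t :+ t :+ 1ᵖ) :+ (:- (t′ :+ 1ᵖ :+ 1ᵖ :+ (t :* t′ :- 1ᵖ))) :* (t :* t′ :- 1ᵖ)) ≡.refl t (t ⁻¹)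

  Φ₃-root⇒≢⁻¹ : ∀ {t} → 3# ≢ 0# → Φ₃ t ≡ 0# → t ≢ t ⁻¹
  Φ₃-root⇒≢⁻¹ {t} 3≢0 root t≡t⁻¹ =
    x≢0∧y≢0⇒x*y≢0 (Φ₃-root⇒1-t≢0 3≢0 root) (Φ₃-root⇒1+t≢0 root)
      (lincomb₂ (- 1#) t certificate (x≡y⇒x-y≡0 (⁻¹-inverse t (Φ₃-root⇒≢0 root))) (x≡y⇒x-y≡0 (≡.sym t≡t⁻¹)))
    where certificate : (1# - t) * (1# + t) ≡ (- 1#) * (t * t ⁻¹ - 1#) + t * (t ⁻¹ - t)
          certificate = solve 2 (λ t t′ → (1ᵖ :- t) :* (1ᵖ :+ t) := (:- 1ᵖ) :* (t :* t′ :- 1ᵖ) :+ t :* (t′ :- t)) ≡.refl t (t ⁻¹)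

  Φ₃-root⇒factorisation : ∀ {t} a b → Φ₃ t ≡ 0# → (b - a * t) * (b - a * t ⁻¹) ≡ a * a + a * b + b * b
  Φ₃-root⇒factorisation {t} a b root = x-y≡0⇒x≡y
    (lincomb₂ (- (a * b * t ⁻¹)) (a * b * (t + 1#) + a * a) certificate root
      (x≡y⇒x-y≡0 (⁻¹-inverse t (Φ₃-root⇒≢0 root))))
    where certificate : (b - a * t) * (b - a * t ⁻¹) - (a * a + a * b + b * b) ≡
                        (- (a * b * t ⁻¹)) * Φ₃ t + (a * b * (t + 1#) + a * a) * (t * t ⁻¹ - 1#)
          certificate = solve 4 (λ a b t t′ → (b :- a :* t) :* (b :- a :* t′) :- (a :* a :+ a :* b :+ b :* b) :=
            (:- (a :* b :* t′)) :* (t :* t :+ t :+ 1ᵖ) :+ (a :* b :* (t :+ 1ᵖ) :+ a :* a) :* (t :* t′ :- 1ᵖ)) ≡.refl a b t (t ⁻¹)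

  Φ₃-homogeneous-root⇒3≢0 : ∀ {a b} → a ≢ b → a * a + a * b + b * b ≡ 0# → 3# ≢ 0#
  Φ₃-homogeneous-root⇒3≢0 {a} {b} a≢b vanishes 3≡0 =
    x≢0∧y≢0⇒x*y≢0 a-b≢0 a-b≢0 (lincomb₂ 1# (- (a * b)) certificate vanishes 3≡0)
    where a-b≢0 : a - b ≢ 0#
          a-b≢0 = λ a-b≡0 → a≢b (x-y≡0⇒x≡y a-b≡0)
          certificate : (a - b) * (a - b) ≡ 1# * (a * a + a * b + b * b) + (- (a * b)) * 3#
          certificate = solve 2 (λ a b → (a :- b) :* (a :- b) :=
            1ᵖ :* (a :* a :+ a :* b :+ b :* b) :+ (:- (a :* b)) :* (1ᵖ :+ 1ᵖ :+ 1ᵖ)) ≡.refl a b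

module Contraction {q : ℕ} (K : FiniteField q) (F : FiniteField.Carrier K) where
  open FiniteField K
  open AGL K F
  open Field K

  module _ (f g : Carrier → Carrier) where

    agree? : Decidable (λ i → f (elt i) ≡ g (elt i))
    agree? i = f (elt i) ≟ g (elt i)

    agreements : List Carrier
    agreements = map elt (filter agree? (allFin q))

    length-agreements+hd : length agreements ℕ.+ hd f g ≡ q
    length-agreements+hd = begin
      length agreements ℕ.+ hd f g                  ≡⟨ ≡.cong (ℕ._+ hd f g) (List.length-map elt (filter agree? (allFin q))) ⟩
      length (filter agree? (allFin q)) ℕ.+ hd f g  ≡⟨ length-filter+length-filter-∁ agree? (allFin q) ⟩
      length (allFin q)                             ≡⟨ List.length-tabulate _ ⟩
      q                                             ∎
      where open ≡.≡-Reasoning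

    agreements-unique : Unique agreements
    agreements-unique = Unique.map⁺ (Bijection.injective enum) (Unique.filter⁺ agree? (Unique.allFin⁺ q))

    ∈-agreements⁻ : ∀ {x} → x ∈ agreements → f x ≡ g x
    ∈-agreements⁻ x∈ with _ , i∈ , ≡.refl ← ∈-map⁻ elt x∈ = proj₂ (∈-filter⁻ agree? {xs = allFin q} i∈)

    ∈-agreements⁺ : ∀ {x} → f x ≡ g x → x ∈ agreements
    ∈-agreements⁺ {x} fx≡gx with i , elt≗x ← Bijection.surjective enum x with ≡.refl ← elt≗x ≡.refl =
      ∈-map⁺ elt (∈-filter⁺ agree? (∈-allFin i) fx≡gx)

    agreements-≤ : ∀ {ys} → (∀ {x} → f x ≡ g x → x ∈ ys) → length agreements ≤ length ys
    agreements-≤ covered = Unique-⊆⇒length≤ agreements-unique (covered ∘ ∈-agreements⁻)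

    agreements-≥ : ∀ {ys} → Unique ys → All (λ x → f x ≡ g x) ys → length ys ≤ length agreements
    agreements-≥ unique agree = Unique-⊆⇒length≤ unique (∈-agreements⁺ ∘ All.lookup agree)

  Agree : Aff → Aff → Carrier → Set
  Agree π σ x = tri π x ≡ tri σ x

  agreementCount : Aff → Aff → ℕ
  agreementCount π σ = length (agreements (tri π) (tri σ))

  -- 4 ≤ q because hd ≡ q ∸ 4 is truncated subtraction.
  Adj⇒agreementCount≡4 : ∀ {π σ} → 4 ≤ q → Adj π σ → agreementCount π σ ≡ 4
  Adj⇒agreementCount≡4 {π} {σ} 4≤q (_ , hd≡q∸4) = ℕ.+-cancelʳ-≡ (q ∸ 4) _ 4 (begin
    agreementCount π σ ℕ.+ (q ∸ 4)           ≡⟨ ≡.cong (agreementCount π σ ℕ.+_) hd≡q∸4 ⟨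
    agreementCount π σ ℕ.+ hd (tri π) (tri σ) ≡⟨ length-agreements+hd (tri π) (tri σ) ⟩
    q                                        ≡⟨ ℕ.m+[n∸m]≡n 4≤q ⟨
    4 ℕ.+ (q ∸ 4)                            ∎)
    where open ≡.≡-Reasoning

  agreementCount≡4⇒Adj : ∀ {π σ} → π ≢ σ → agreementCount π σ ≡ 4 → Adj π σ
  agreementCount≡4⇒Adj {π} {σ} π≢σ four = π≢σ , (begin
    hd (tri π) (tri σ)                               ≡⟨ ℕ.m+n∸m≡n 4 _ ⟨
    4 ℕ.+ hd (tri π) (tri σ) ∸ 4                     ≡⟨ ≡.cong (λ n → n ℕ.+ hd (tri π) (tri σ) ∸ 4) four ⟨
    agreementCount π σ ℕ.+ hd (tri π) (tri σ) ∸ 4    ≡⟨ ≡.cong (_∸ 4) (length-agreements+hd (tri π) (tri σ)) ⟩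
    q ∸ 4                                            ∎)
    where open ≡.≡-Reasoning

  apply-difference : ∀ a r b s x → apply (a , r) x - apply (b , s) x ≡ (a - b) * x - (s - r)
  apply-difference = solve 5 (λ a r b s x → (a :* x :+ r) :- (b :* x :+ s) := (a :- b) :* x :- (s :- r)) ≡.refl

  crossing : Aff → Aff → Carrier
  crossing (a , r) (b , s) = (s - r) * (a - b) ⁻¹

  crossing-unique : ∀ {a r b s x} → a ≢ b → apply (a , r) x ≡ apply (b , s) x → x ≡ crossing (a , r) (b , s)
  crossing-unique {a} {r} {b} {s} {x} a≢b πx≡σx = x*y≡z⇒y≡z*x⁻¹ (a≢b ∘ x-y≡0⇒x≡y)
    (x-y≡0⇒x≡y (≡.trans (≡.sym (apply-difference a r b s x)) (x≡y⇒x-y≡0 πx≡σx)))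

  apply-crossing : ∀ {a r b s} → a ≢ b →
                   apply (a , r) (crossing (a , r) (b , s)) ≡ apply (b , s) (crossing (a , r) (b , s))
  apply-crossing {a} {r} {b} {s} a≢b = x-y≡0⇒x≡y (≡.trans (apply-difference a r b s _)
    (x≡y⇒x-y≡0 (x*[y*x⁻¹]≡y (s - r) (a≢b ∘ x-y≡0⇒x≡y))))

  same-slope-coincide⇒≡ : ∀ {a r s x} → apply (a , r) x ≡ apply (a , s) x → (a , r) ≡ (a , s)
  same-slope-coincide⇒≡ {a} {r} {s} {x} πx≡σx = ≡.cong (a ,_) (∙-cancelˡ (a * x) r s πx≡σx)

  -- π⁻¹(F) is where π crosses the constant map x ↦ F.
  preimage : Aff → Carrier
  preimage π = crossing π (0# , F)

  apply-const : ∀ x → apply (0# , F) x ≡ F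
  apply-const x = ≡.trans (≡.cong (_+ F) (zeroˡ x)) (+-identityˡ F)

  apply-preimage : ∀ {π} → IsVertex π → apply π (preimage π) ≡ F
  apply-preimage {a , r} a≢0 = ≡.trans (apply-crossing a≢0) (apply-const _)

  preimage-unique : ∀ {π x} → IsVertex π → apply π x ≡ F → x ≡ preimage π
  preimage-unique {a , r} a≢0 πx≡F = crossing-unique a≢0 (≡.trans πx≡F (≡.sym (apply-const _)))

  tri-at-F : ∀ π → tri π F ≡ F
  tri-at-F π with F ≟ F
  ... | yes _ = ≡.refl
  ... | no F≢F = contradiction ≡.refl F≢F

  tri-at-preimage : ∀ π {x} → x ≢ F → apply π x ≡ F → tri π x ≡ apply π F
  tri-at-preimage π {x} x≢F πx≡F with x ≟ F
  ... | yes x≡F = contradiction x≡F x≢F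
  ... | no _ with apply π x ≟ F
  ...   | yes _ = ≡.refl
  ...   | no πx≢F = contradiction πx≡F πx≢F

  tri-elsewhere : ∀ π {x} → x ≢ F → apply π x ≢ F → tri π x ≡ apply π x
  tri-elsewhere π {x} x≢F πx≢F with x ≟ F
  ... | yes x≡F = contradiction x≡F x≢F
  ... | no _ with apply π x ≟ F
  ...   | yes πx≡F = contradiction πx≡F πx≢F
  ...   | no _ = ≡.refl

  slope-relation : ∀ {a r b s u v} → apply (a , r) u ≡ F → apply (b , s) v ≡ F →
                   apply (a , r) F ≡ apply (b , s) u → apply (b , s) F ≡ apply (a , r) v → u ≢ F →
                   a * a + a * b + b * b ≡ 0#
  slope-relation {a} {r} {b} {s} {u} {v} πu≡F σv≡F πF≡σu σF≡πv u≢F =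
    *-cancelˡ (u≢F ∘ x-y≡0⇒x≡y) (≡.trans vanishes (≡.sym (zeroʳ (u - F))))
    where
    certificate : (u - F) * (a * a + a * b + b * b) ≡
                  a * (a * u + r - F) + (- a) * (b * v + s - F) +
                  (- (a + b)) * (a * F + r - (b * u + s)) + (- b) * (b * F + s - (a * v + r))
    certificate = solve 7 (λ a r b s u v f → (u :- f) :* (a :* a :+ a :* b :+ b :* b) :=
      a :* (a :* u :+ r :- f) :+ (:- a) :* (b :* v :+ s :- f) :+
      (:- (a :+ b)) :* (a :* f :+ r :- (b :* u :+ s)) :+ (:- b) :* (b :* f :+ s :- (a :* v :+ r))) ≡.refl a r b s u v F
    vanishes : (u - F) * (a * a + a * b + b * b) ≡ 0#
    vanishes = lincomb₄ a (- a) (- (a + b)) (- b) certificate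
      (x≡y⇒x-y≡0 πu≡F) (x≡y⇒x-y≡0 σv≡F) (x≡y⇒x-y≡0 πF≡σu) (x≡y⇒x-y≡0 σF≡πv)

  neighbour : Aff → Carrier → Aff
  neighbour (a , r) t = (a * t , (a - t) * F + r * (1# + t))

  neighbour-translation : ∀ {a r b s u t} → apply (a , r) u ≡ F → apply (a , r) F ≡ apply (b , s) u →
                          b ≡ a * t → (b , s) ≡ neighbour (a , r) t
  neighbour-translation {a} {r} {b} {s} {u} {t} πu≡F πF≡σu b≡at = ≡.cong₂ _,_ b≡at (x-y≡0⇒x≡y
    (lincomb₃ (- t) (- 1#) (- u) certificate (x≡y⇒x-y≡0 πu≡F) (x≡y⇒x-y≡0 πF≡σu) (x≡y⇒x-y≡0 b≡at)))
    where
    certificate : s - ((a - t) * F + r * (1# + t)) ≡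
                  (- t) * (a * u + r - F) + (- 1#) * (a * F + r - (b * u + s)) + (- u) * (b - a * t)
    certificate = solve 7 (λ a r b s u t f → s :- ((a :- t) :* f :+ r :* (1ᵖ :+ t)) :=
      (:- t) :* (a :* u :+ r :- f) :+ (:- 1ᵖ) :* (a :* f :+ r :- (b :* u :+ s)) :+ (:- u) :* (b :- a :* t))
      ≡.refl a r b s u t F

  neighbour-at-preimage : ∀ {a r u} t → apply (a , r) u ≡ F → apply (neighbour (a , r) t) u ≡ apply (a , r) F
  neighbour-at-preimage {a} {r} {u} t πu≡F = x-y≡0⇒x≡y (lincomb₁ t certificate (x≡y⇒x-y≡0 πu≡F))
    where
    certificate : apply (neighbour (a , r) t) u - apply (a , r) F ≡ t * (a * u + r - F)
    certificate = solve 5 (λ a r t u f → a :* t :* u :+ ((a :- t) :* f :+ r :* (1ᵖ :+ t)) :- (a :* f :+ r) :=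
      t :* (a :* u :+ r :- f)) ≡.refl a r t u F

  neighbour-at-F : ∀ a r t → apply (neighbour (a , r) t) F - F ≡ (1# + t) * (apply (a , r) F - F)
  neighbour-at-F a r t = solve 4 (λ a r t f → a :* t :* f :+ ((a :- t) :* f :+ r :* (1ᵖ :+ t)) :- f :=
    (1ᵖ :+ t) :* (a :* f :+ r :- f)) ≡.refl a r t F

  neighbour-at-F′ : ∀ a r t → apply (neighbour (a , r) t) F - apply (a , r) F ≡ t * (apply (a , r) F - F)
  neighbour-at-F′ a r t = solve 4 (λ a r t f → a :* t :* f :+ ((a :- t) :* f :+ r :* (1ᵖ :+ t)) :- (a :* f :+ r) :=
    t :* (a :* f :+ r :- f)) ≡.refl a r t F

  neighbour-at-its-preimage : ∀ {a r t v} → Φ₃ t ≡ 0# → apply (neighbour (a , r) t) v ≡ F →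
                              apply (a , r) v ≡ apply (neighbour (a , r) t) F
  neighbour-at-its-preimage {a} {r} {t} {v} root σv≡F =
    x-y≡0⇒x≡y (lincomb₂ (- (1# + t)) (a * v + r - F) certificate (x≡y⇒x-y≡0 σv≡F) root)
    where
    certificate : apply (a , r) v - apply (neighbour (a , r) t) F ≡
                  (- (1# + t)) * (apply (neighbour (a , r) t) v - F) + (a * v + r - F) * Φ₃ t
    certificate = solve 5 (λ a r t v f → a :* v :+ r :- (a :* t :* f :+ ((a :- t) :* f :+ r :* (1ᵖ :+ t))) :=
      (:- (1ᵖ :+ t)) :* (a :* t :* v :+ ((a :- t) :* f :+ r :* (1ᵖ :+ t)) :- f) :+ (a :* v :+ r :- f) :* (t :* t :+ t :+ 1ᵖ))
      ≡.refl a r t v F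

  module Pair {a r b s : Carrier} (a≢0 : a ≢ 0#) (b≢0 : b ≢ 0#) (π≢σ : (a , r) ≢ (b , s)) where

    π σ : Aff
    π = (a , r)
    σ = (b , s)

    u v : Carrier
    u = preimage π
    v = preimage σ

    πu≡F : apply π u ≡ F
    πu≡F = apply-preimage a≢0

    σv≡F : apply σ v ≡ F
    σv≡F = apply-preimage b≢0

    agree⇒special⊎coincide : ∀ {x} → Agree π σ x → x ∈ F ∷ u ∷ v ∷ [] ⊎ apply π x ≡ apply σ x
    agree⇒special⊎coincide {x} agree = by-cases (x ≟ F) (apply π x ≟ F) (apply σ x ≟ F)
      where
      by-cases : Dec (x ≡ F) → Dec (apply π x ≡ F) → Dec (apply σ x ≡ F) →
                 x ∈ F ∷ u ∷ v ∷ [] ⊎ apply π x ≡ apply σ x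
      by-cases (yes x≡F) _          _          = inj₁ (here x≡F)
      by-cases (no _)    (yes πx≡F) _          = inj₁ (there (here (preimage-unique a≢0 πx≡F)))
      by-cases (no _)    (no _)     (yes σx≡F) = inj₁ (there (there (here (preimage-unique b≢0 σx≡F))))
      by-cases (no x≢F)  (no πx≢F)  (no σx≢F)  =
        inj₂ (≡.trans (≡.sym (tri-elsewhere π x≢F πx≢F)) (≡.trans agree (tri-elsewhere σ x≢F σx≢F)))

    cover-same-slope : a ≡ b → ∀ {x} → Agree π σ x → x ∈ F ∷ u ∷ v ∷ []
    cover-same-slope ≡.refl agree with agree⇒special⊎coincide agree
    ... | inj₁ x∈ = x∈
    ... | inj₂ πx≡σx = contradiction (same-slope-coincide⇒≡ πx≡σx) π≢σ

    cover-distinct-slopes : a ≢ b → ∀ {x} → Agree π σ x → x ∈ F ∷ u ∷ v ∷ crossing π σ ∷ []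
    cover-distinct-slopes a≢b agree with agree⇒special⊎coincide agree
    ... | inj₁ x∈ = ∈-++⁺ˡ x∈
    ... | inj₂ πx≡σx = there (there (there (here (crossing-unique a≢b πx≡σx))))

    agreementCount≤4 : agreementCount π σ ≤ 4
    agreementCount≤4 with a ≟ b
    ... | yes a≡b = ℕ.m≤n⇒m≤1+n (agreements-≤ (tri π) (tri σ) (cover-same-slope a≡b))
    ... | no a≢b = agreements-≤ (tri π) (tri σ) (cover-distinct-slopes a≢b)

    module Adjacent (four : agreementCount π σ ≡ 4) where

      no-cover-by-three : ∀ {x₁ x₂ x₃} → ¬ (∀ {x} → Agree π σ x → x ∈ x₁ ∷ x₂ ∷ x₃ ∷ [])
      no-cover-by-three covered with ℕ.≤-trans (ℕ.≤-reflexive (≡.sym four)) (agreements-≤ (tri π) (tri σ) covered)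
      ... | s≤s (s≤s (s≤s ()))

      a≢b : a ≢ b
      a≢b a≡b = no-cover-by-three (cover-same-slope a≡b)

      w : Carrier
      w = crossing π σ

      redundant-u : ¬ (∀ {x} → Agree π σ x → x ≡ u → x ∈ F ∷ v ∷ w ∷ [])
      redundant-u redundant = no-cover-by-three λ agree → drop-u agree (cover-distinct-slopes a≢b agree)
        where drop-u : ∀ {x} → Agree π σ x → x ∈ F ∷ u ∷ v ∷ w ∷ [] → x ∈ F ∷ v ∷ w ∷ []
              drop-u _     (here x≡F)         = here x≡F
              drop-u agree (there (here x≡u)) = redundant agree x≡u
              drop-u _     (there (there x∈)) = there x∈

      redundant-v : ¬ (∀ {x} → Agree π σ x → x ≡ v → x ∈ F ∷ u ∷ w ∷ [])
      redundant-v redundant = no-cover-by-three λ agree → drop-v agree (cover-distinct-slopes a≢b agree)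
        where drop-v : ∀ {x} → Agree π σ x → x ∈ F ∷ u ∷ v ∷ w ∷ [] → x ∈ F ∷ u ∷ w ∷ []
              drop-v _     (here x≡F)                 = here x≡F
              drop-v _     (there (here x≡u))         = there (here x≡u)
              drop-v agree (there (there (here x≡v))) = redundant agree x≡v
              drop-v _     (there (there (there x∈))) = there (there x∈)

      u≢F : u ≢ F
      u≢F u≡F = redundant-u λ _ x≡u → here (≡.trans x≡u u≡F)

      v≢F : v ≢ F
      v≢F v≡F = redundant-v λ _ x≡v → here (≡.trans x≡v v≡F)

      u≢v : u ≢ v
      u≢v u≡v = redundant-u λ _ x≡u → there (here (≡.trans x≡u u≡v))

      agree-u : Agree π σ u
      agree-u = decidable-stable (tri π u ≟ tri σ u) λ disagree →
        redundant-u λ { agree ≡.refl → contradiction agree disagree }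

      agree-v : Agree π σ v
      agree-v = decidable-stable (tri π v ≟ tri σ v) λ disagree →
        redundant-v λ { agree ≡.refl → contradiction agree disagree }

      πF≡σu : apply π F ≡ apply σ u
      πF≡σu = begin
        apply π F   ≡⟨ tri-at-preimage π u≢F πu≡F ⟨
        tri π u     ≡⟨ agree-u ⟩
        tri σ u     ≡⟨ tri-elsewhere σ u≢F (u≢v ∘ preimage-unique b≢0) ⟩
        apply σ u   ∎
        where open ≡.≡-Reasoning

      σF≡πv : apply σ F ≡ apply π v
      σF≡πv = begin
        apply σ F   ≡⟨ tri-at-preimage σ v≢F σv≡F ⟨
        tri σ v     ≡⟨ agree-v ⟨
        tri π v     ≡⟨ tri-elsewhere π v≢F (u≢v ∘ ≡.sym ∘ preimage-unique a≢0) ⟩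
        apply π v   ∎
        where open ≡.≡-Reasoning

      slopes-vanish : a * a + a * b + b * b ≡ 0#
      slopes-vanish = slope-relation πu≡F σv≡F πF≡σu σF≡πv u≢F

      3≢0 : 3# ≢ 0#
      3≢0 = Φ₃-homogeneous-root⇒3≢0 a≢b slopes-vanish

      σ≡neighbour : ∀ {t} → Φ₃ t ≡ 0# → σ ≡ neighbour π t ⊎ σ ≡ neighbour π (t ⁻¹)
      σ≡neighbour {t} root = Sum.map translation translation
        (x*y≡0⇒x≡0⊎y≡0 (≡.trans (Φ₃-root⇒factorisation a b root) slopes-vanish))
        where translation : ∀ {t′} → b - a * t′ ≡ 0# → σ ≡ neighbour π t′
              translation {t′} b-at′≡0 = neighbour-translation {a} {r} {b} {s} {u} {t′} πu≡F πF≡σu (x-y≡0⇒x≡y b-at′≡0)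

  module Neighbour {a r t : Carrier} (a≢0 : a ≢ 0#) (root : Φ₃ t ≡ 0#) (3≢0 : 3# ≢ 0#)
                   (u≢F : preimage (a , r) ≢ F) where

    π σ : Aff
    π = (a , r)
    σ = neighbour π t

    vertex : IsVertex σ
    vertex = x≢0∧y≢0⇒x*y≢0 a≢0 (Φ₃-root⇒≢0 root)

    slopes-differ : a ≢ a * t
    slopes-differ a≡at = x≢0∧y≢0⇒x*y≢0 a≢0 (Φ₃-root⇒1-t≢0 3≢0 root)
      (lincomb₁ 1# certificate (x≡y⇒x-y≡0 a≡at))
      where certificate : a * (1# - t) ≡ 1# * (a - a * t)
            certificate = solve 2 (λ a t → a :* (1ᵖ :- t) := 1ᵖ :* (a :- a :* t)) ≡.refl a t

    π≢σ : π ≢ σ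
    π≢σ = slopes-differ ∘ ≡.cong proj₁

    u v w : Carrier
    u = preimage π
    v = preimage σ
    w = crossing π σ

    πu≡F : apply π u ≡ F
    πu≡F = apply-preimage a≢0

    σv≡F : apply σ v ≡ F
    σv≡F = apply-preimage vertex

    πw≡σw : apply π w ≡ apply σ w
    πw≡σw = apply-crossing {a} {r} {a * t} {(a - t) * F + r * (1# + t)} slopes-differ

    πF≢F : apply π F ≢ F
    πF≢F πF≡F = u≢F (≡.sym (preimage-unique a≢0 πF≡F))

    σu≡πF : apply σ u ≡ apply π F
    σu≡πF = neighbour-at-preimage {a} {r} {u} t πu≡F

    σF≢F : apply σ F ≢ F
    σF≢F σF≡F = x≢0∧y≢0⇒x*y≢0 (Φ₃-root⇒1+t≢0 root) (πF≢F ∘ x-y≡0⇒x≡y)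
      (≡.trans (≡.sym (neighbour-at-F a r t)) (x≡y⇒x-y≡0 σF≡F))

    σF≢πF : apply σ F ≢ apply π F
    σF≢πF σF≡πF = x≢0∧y≢0⇒x*y≢0 (Φ₃-root⇒≢0 root) (πF≢F ∘ x-y≡0⇒x≡y)
      (≡.trans (≡.sym (neighbour-at-F′ a r t)) (x≡y⇒x-y≡0 σF≡πF))

    πv≡σF : apply π v ≡ apply σ F
    πv≡σF = neighbour-at-its-preimage {a} {r} {t} {v} root σv≡F

    v≢F : v ≢ F
    v≢F v≡F = σF≢F (≡.subst (λ x → apply σ x ≡ F) v≡F σv≡F)

    u≢v : u ≢ v
    u≢v u≡v = πF≢F (≡.trans (≡.sym σu≡πF) (≡.subst (λ x → apply σ x ≡ F) (≡.sym u≡v) σv≡F))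

    coincide-at : ∀ {x} → x ≡ w → apply π x ≡ apply σ x
    coincide-at ≡.refl = πw≡σw

    w≢F : w ≢ F
    w≢F w≡F = σF≢πF (≡.sym (coincide-at (≡.sym w≡F)))

    u≢w : u ≢ w
    u≢w u≡w = πF≢F (≡.trans (≡.sym σu≡πF) (≡.trans (≡.sym (coincide-at u≡w)) πu≡F))

    v≢w : v ≢ w
    v≢w v≡w = σF≢F (≡.trans (≡.sym πv≡σF) (≡.trans (coincide-at v≡w) σv≡F))

    agree-F : Agree π σ F
    agree-F = ≡.trans (tri-at-F π) (≡.sym (tri-at-F σ))

    agree-u : Agree π σ u
    agree-u = ≡.trans (tri-at-preimage π u≢F πu≡F)
      (≡.sym (≡.trans (tri-elsewhere σ u≢F (πF≢F ∘ ≡.trans (≡.sym σu≡πF))) σu≡πF))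

    agree-v : Agree π σ v
    agree-v = ≡.trans (tri-elsewhere π v≢F (σF≢F ∘ ≡.trans (≡.sym πv≡σF)))
      (≡.trans πv≡σF (≡.sym (tri-at-preimage σ v≢F σv≡F)))

    agree-w : Agree π σ w
    agree-w = ≡.trans (tri-elsewhere π w≢F (u≢w ∘ ≡.sym ∘ preimage-unique a≢0))
      (≡.trans πw≡σw (≡.sym (tri-elsewhere σ w≢F (v≢w ∘ ≡.sym ∘ preimage-unique vertex))))

    distinct : Unique (F ∷ u ∷ v ∷ w ∷ [])
    distinct = (≢-sym u≢F ∷ ≢-sym v≢F ∷ ≢-sym w≢F ∷ []) ∷ (u≢v ∷ u≢w ∷ []) ∷ (v≢w ∷ []) ∷ [] ∷ []

    adjacent : Adj π σ
    adjacent = agreementCount≡4⇒Adj π≢σ (ℕ.≤-antisym (Pair.agreementCount≤4 a≢0 vertex π≢σ)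
      (agreements-≥ (tri π) (tri σ) distinct (agree-F ∷ agree-u ∷ agree-v ∷ agree-w ∷ [])))

  4≤q : q % 3 ≡ 1 → 4 ≤ q
  4≤q q%3≡1 = %3≡1⇒4≤ q%3≡1 λ i≡j → 0≢1 (≡.trans (≡.sym (elt-index 0#)) (≡.trans (≡.cong elt i≡j) (elt-index 1#)))
    where elt-index : ∀ y → elt (proj₁ (Bijection.surjective enum y)) ≡ y
          elt-index y = proj₂ (Bijection.surjective enum y) ≡.refl

  neighbours-distinct : ∀ {π t} → IsVertex π → 3# ≢ 0# → Φ₃ t ≡ 0# → neighbour π t ≢ neighbour π (t ⁻¹)
  neighbours-distinct {a , r} a≢0 3≢0 root = Φ₃-root⇒≢⁻¹ 3≢0 root ∘ *-cancelˡ a≢0 ∘ ≡.cong proj₁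

  adjacent⇒neighbour : ∀ {π σ t} → 4 ≤ q → IsVertex π → IsVertex σ → Φ₃ t ≡ 0# → Adj π σ →
                       σ ≡ neighbour π t ⊎ σ ≡ neighbour π (t ⁻¹)
  adjacent⇒neighbour {a , r} {b , s} 4≤q a≢0 b≢0 root adj =
    Pair.Adjacent.σ≡neighbour a≢0 b≢0 (proj₁ adj) (Adj⇒agreementCount≡4 4≤q adj) root

lemma5 : (q : ℕ) → q % 3 ≡ 1 → (K : FiniteField q) → (F : FiniteField.Carrier K) →
  let open FiniteField K
      open AGL K F
  in (a r t₁ : Carrier) → a ≢ 0# → t₁ * t₁ + t₁ + 1# ≡ 0# →
     NonIsolated (a , r) →
     let σ₁ = (a * t₁ , (a - t₁) * F + r * (1# + t₁))
         σ₂ = (a * (t₁ ⁻¹) , (a - (t₁ ⁻¹)) * F + r * (1# + (t₁ ⁻¹)))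
     in IsVertex σ₁ × IsVertex σ₂ × σ₁ ≢ σ₂ ×
        ((σ : Aff) → IsVertex σ → (Adj (a , r) σ ⇔ (σ ≡ σ₁ ⊎ σ ≡ σ₂)))
lemma5 q q%3≡1 K F a r t₁ a≢0 root ((b , s) , b≢0 , adj) =
  N₁.vertex , N₂.vertex , neighbours-distinct a≢0 Given.3≢0 root , λ σ σ-vertex →
    mk⇔ (adjacent⇒neighbour (4≤q q%3≡1) a≢0 σ-vertex root) [ (λ { ≡.refl → N₁.adjacent }) , (λ { ≡.refl → N₂.adjacent }) ]
  where
  open FiniteField K
  open Field K
  open Contraction K F
  -- The neighbour witnessing non-isolation shows 3 ≢ 0 and π⁻¹(F) ≢ F.
  module Given = Pair.Adjacent a≢0 b≢0 (proj₁ adj) (Adj⇒agreementCount≡4 (4≤q q%3≡1) adj)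
  module N₁ = Neighbour a≢0 root Given.3≢0 Given.u≢F
  module N₂ = Neighbour a≢0 (Φ₃-root⇒⁻¹-root root) Given.3≢0 Given.u≢F
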